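{- Let $K\subseteq L$ be finite fields, $U$ a $K$-vector space of dimension $k$, and $\lambda = (\lambda_1,\dots,\lambda_m) \in \mathrm{Hom}_K(U, L^m)$, where $\lambda_i \in \mathrm{Hom}_K(U,L)$ is the $i$th coordinate of $\lambda$. Put $V_i = \lambda_i^*(L) \subseteq U$ for $i = 1,\dots,m$. Then for every $u \in U$, $$\mathrm{wt}(\lambda(u)) = m - \sum_{v\in U}\Big(\sum_{i=1}^m \frac{1}{|V_i|}\mathbf{1}_{V_i}(v)\Big)\chi_v(u).$$
   Context: $\mathrm{wt}$ is the Hamming weight on $L^m$ (number of nonzero coordinates); $\mathbf{1}_Y$ is the indicator function of $Y$. Fix a $K$-basis of $U$ and of $L$, identifying $U=K^k$, $L=K^n$. For $\sigma\in\mathrm{Hom}_K(U,L)$ let $M\in M_{k\times n}(K)$ be the unique matrix with $\sigma(u) = M^Tu$; the dual map is $\sigma^*(b) = Mb$, $\sigma^*\in\mathrm{Hom}_K(L,U)$. Fix a nontrivial character $\pi$ of $(K,+)$ (homomorphism to $(\mathbb{C}^*,\times)$), and for $v,u\in U$ set $\chi_v(u) = \pi\big(\sum_{j=1}^k v_j u_j\big)$. -}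

module Defs where

open import Level using (Level; 0ℓ; _⊔_) renaming (suc to lsuc)
open import Algebra.Bundles using (CommutativeRing)
open import Data.Nat using (ℕ; zero; suc)
open import Data.Fin using (Fin; zero; suc)
open import Data.List using (List; []; _∷_; map; concatMap; foldr; filter; length)
open import Data.List.Membership.Propositional using (_∈_)
open import Data.List.Relation.Unary.Unique.Propositional using (Unique)
open import Data.List.Relation.Unary.Any using (any?)
open import Data.Fin.Properties using (all?)
open import Data.Product using (Σ; ∃; _×_; _,_)
open import Relation.Nullary using (¬_; Dec; yes; no)
open import Relation.Nullary using (¬?)
open import Relation.Binary.PropositionalEquality using (_≡_)
open import Relation.Binary.Definitions using (DecidableEquality)

fromℕ : ∀ {c ℓ} (R : CommutativeRing c ℓ) → ℕ → CommutativeRing.Carrier R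
fromℕ R zero = CommutativeRing.0# R
fromℕ R (suc n) = CommutativeRing._+_ R (CommutativeRing.1# R) (fromℕ R n)

-- A field (with a total inversion map; the value of 0⁻¹ is irrelevant),
-- equality is the setoid equality of the underlying commutative ring.
record Field (c ℓ : Level) : Set (lsuc (c ⊔ ℓ)) where
  field
    commutativeRing : CommutativeRing c ℓ
  open CommutativeRing commutativeRing public
  field
    _⁻¹      : Carrier → Carrier
    inverseʳ : ∀ x → ¬ (x ≈ 0#) → (x * (x ⁻¹)) ≈ 1#
    0≉1      : ¬ (0# ≈ 1#)

CharZero : ∀ {c ℓ} → Field c ℓ → Set ℓ
CharZero F = ∀ n → ¬ (Field._≈_ F (fromℕ (Field.commutativeRing F) (suc n)) (Field.0# F))

record FiniteField : Set₁ where
  field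
    field'   : Field 0ℓ 0ℓ
  open Field field' public
  field
    ≈⇒≡      : ∀ {x y} → x ≈ y → x ≡ y
    _≟_      : DecidableEquality Carrier
    elements : List Carrier
    complete : ∀ x → x ∈ elements
    unique   : Unique elements

module Setup {c ℓ} (K : FiniteField) (F : Field c ℓ) where
  private
    module K = FiniteField K
    module F = Field F

  Vecᴷ : ℕ → Set
  Vecᴷ k = Fin k → K.Carrier

  Mat : ℕ → ℕ → Set
  Mat k n = Fin k → Fin n → K.Carrier

  ∑ᴷ : ∀ n → (Fin n → K.Carrier) → K.Carrier
  ∑ᴷ zero f = K.0#
  ∑ᴷ (suc n) f = f zero K.+ ∑ᴷ n (λ i → f (suc i))

  ∑ᶠ : ∀ n → (Fin n → F.Carrier) → F.Carrier
  ∑ᶠ zero f = F.0#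
  ∑ᶠ (suc n) f = f zero F.+ ∑ᶠ n (λ i → f (suc i))

  ∑ᴸ : ∀ {A : Set} → List A → (A → F.Carrier) → F.Carrier
  ∑ᴸ xs f = foldr (λ x s → f x F.+ s) F.0# xs

  cons : ∀ {k} → K.Carrier → Vecᴷ k → Vecᴷ (suc k)
  cons a v zero = a
  cons a v (suc i) = v i

  allVecs : ∀ k → List (Vecᴷ k)
  allVecs zero = (λ ()) ∷ []
  allVecs (suc k) = concatMap (λ a → map (cons a) (allVecs k)) K.elements

  -- σ(u) = Mᵀ u  (σ ∈ Hom_K(U,L), U = K^k, L = K^n)
  applyᵀ : ∀ {k n} → Mat k n → Vecᴷ k → Vecᴷ n
  applyᵀ M u j = ∑ᴷ _ (λ r → M r j K.* u r)

  -- σ*(b) = M b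
  apply : ∀ {k n} → Mat k n → Vecᴷ n → Vecᴷ k
  apply M b r = ∑ᴷ _ (λ j → M r j K.* b j)

  _≋_ : ∀ {k} → Vecᴷ k → Vecᴷ k → Set
  v ≋ w = ∀ i → v i ≡ w i

  _≋?_ : ∀ {k} (v w : Vecᴷ k) → Dec (v ≋ w)
  v ≋? w = all? (λ i → v i K.≟ w i)

  NonZero : ∀ {n} → Vecᴷ n → Set
  NonZero b = ¬ (b ≋ (λ _ → K.0#))

  NonZero? : ∀ {n} (b : Vecᴷ n) → Dec (NonZero b)
  NonZero? b = ¬? (b ≋? (λ _ → K.0#))

  -- Hamming weight on L^m, an element of L^m given as m vectors of L = K^n
  wt : ∀ {m n} → (Fin m → Vecᴷ n) → ℕ
  wt {m} x = length (filter (λ i → NonZero? (x i)) (Data.List.tabulate {n = m} (λ i → i)))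
    where import Data.List

  _∈Im_ : ∀ {k n} → Vecᴷ k → Mat k n → Set
  v ∈Im M = Σ _ λ b → b ∈ allVecs _ × (apply M b ≋ v)

  _∈Im?_ : ∀ {k n} (v : Vecᴷ k) (M : Mat k n) → Dec (v ∈Im M)
  v ∈Im? M with any? (λ b → apply M b ≋? v) (allVecs _)
  ... | yes p = yes (helper p)
    where
      open import Data.List.Membership.Propositional using (find)
      helper : _ → v ∈Im M
      helper p with find p
      ... | b , b∈ , eq = b , b∈ , eq
  ... | no ¬p = no (λ { (b , b∈ , eq) → ¬p (lose b∈ eq) })
    where open import Data.List.Membership.Propositional using (lose)

  𝟙 : ∀ {k n} → Mat k n → Vecᴷ k → F.Carrier
  𝟙 M v with v ∈Im? M
  ... | yes _ = F.1#
  ... | no _ = F.0#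

  card : ∀ {k n} → Mat k n → ℕ
  card {k} M = length (filter (λ v → v ∈Im? M) (allVecs k))

  record Character : Set (c ⊔ ℓ) where
    field
      π        : K.Carrier → F.Carrier
      hom      : ∀ a b → π (a K.+ b) F.≈ (π a F.* π b)
      nonzero  : ∀ a → ¬ (π a F.≈ F.0#)
      nontriv  : ∃ λ a → ¬ (π a F.≈ F.1#)

  χ : Character → ∀ {k} → Vecᴷ k → Vecᴷ k → F.Carrier
  χ ψ {k} v u = Character.π ψ (∑ᴷ k (λ j → v j K.* u j))

module Submission where

-- Write V = σ*(L) for a coordinate σ = λᵢ. For v ∈ V, say v = σ*(b), one has
-- ⟨v, u⟩ = ⟨b, σ(u)⟩, so if σ(u) = 0 every χ_v(u) with v ∈ V equals 1 and
-- ∑_{v ∈ V} χ_v(u) = |V|. If σ(u) ≠ 0, the pairing v ↦ ⟨v, u⟩ is onto K on V,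
-- so some v₀ ∈ V has χ_{v₀}(u) ≠ 1; translating the sum by v₀ multiplies it by
-- χ_{v₀}(u), hence it vanishes. Thus |Vᵢ|⁻¹ ∑_{v ∈ Vᵢ} χ_v(u) is the indicator of
-- λᵢ(u) = 0 (|Vᵢ| is invertible as F has characteristic zero), and summing over
-- i counts the zero coordinates of λ(u), which is m − wt(λ(u)).

open import Defs
open import Data.Nat using (ℕ)
open import Data.Fin using (Fin)

open import Algebra.Bundles using (CommutativeRing)
open import Level using (Level)
open import Data.Empty using (⊥-elim)
open import Data.Fin using (zero; suc)
open import Data.Fin.Properties using (¬∀⟶∃¬; suc-injective) renaming (_≟_ to _≟ᶠ_)
open import Data.List using (List; []; _∷_; _++_; map; concatMap; foldr; filter; length; tabulate)
open import Data.List.Membership.Propositional using (_∈_; _∉_)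
open import Data.List.Membership.Propositional.Properties using (∈-map⁺; ∈-concatMap⁺; ∈-filter⁺; ∈-length)
open import Data.List.Relation.Unary.All.Properties using (All¬⇒¬Any)
open import Data.List.Relation.Unary.AllPairs using (_∷_)
open import Data.List.Relation.Unary.Any using (here; there)
import Data.List.Relation.Unary.Any as Any
open import Data.List.Relation.Unary.Unique.Propositional using (Unique)
open import Data.Nat using (zero; suc; _<_)
open import Data.Product using (∃; _×_; _,_)
open import Function using (_∘_)
open import Relation.Binary.Definitions using (DecidableEquality)
open import Relation.Binary.PropositionalEquality as ≡ using (_≡_)
open import Relation.Nullary using (¬_; Dec; yes; no; ¬?)
open import Relation.Unary using (Decidable)

module Sums {c ℓ} (R : CommutativeRing c ℓ) where
  open CommutativeRing R hiding (zero)
  open import Algebra.Properties.Semiring.Sum semiring public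
  open import Algebra.Properties.Ring ring using (-0#≈0#; -‿+-comm)
  open import Algebra.Properties.CommutativeSemigroup +-commutativeSemigroup
    using () renaming (interchange to +-interchange)
  open import Relation.Binary.Reasoning.Setoid setoid

  when : ∀ {p} {P : Set p} → Dec P → Carrier → Carrier
  when (yes _) x = x
  when (no _)  _ = 0#

  when-cong : ∀ {p q} {P : Set p} {Q : Set q} → (P → Q) → (Q → P) →
              (d : Dec P) (e : Dec Q) (x : Carrier) → when d x ≈ when e x
  when-cong _ _ (yes _) (yes _) _ = refl
  when-cong f _ (yes p) (no ¬q) _ = ⊥-elim (¬q (f p))
  when-cong _ g (no ¬p) (yes q) _ = ⊥-elim (¬p (g q))
  when-cong _ _ (no _)  (no _)  _ = refl

  when-¬?+when : ∀ {p} {P : Set p} (d : Dec P) → when (¬? d) 1# + when d 1# ≈ 1#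
  when-¬?+when (yes _) = +-identityˡ 1#
  when-¬?+when (no _)  = +-identityʳ 1#

  ∑-neg : ∀ {n} (f : Fin n → Carrier) → ∑[ i < n ] (- f i) ≈ - ∑[ i < n ] f i
  ∑-neg {zero}  f = sym -0#≈0#
  ∑-neg {suc n} f = trans (+-congˡ (∑-neg (f ∘ suc))) (-‿+-comm _ _)

  ∑-when-≟ : ∀ {n} (j : Fin n) (f : Fin n → Carrier) → ∑[ i < n ] when (i ≟ᶠ j) (f i) ≈ f j
  ∑-when-≟ {suc n} zero    f = trans (+-congˡ (sum-replicate-zero n)) (+-identityʳ (f zero))
  ∑-when-≟ {suc n} (suc j) f = begin
    0# + ∑[ i < n ] when (suc i ≟ᶠ suc j) (f (suc i))
      ≈⟨ +-identityˡ _ ⟩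
    ∑[ i < n ] when (suc i ≟ᶠ suc j) (f (suc i))
      ≈⟨ sum-cong-≋ (λ i → when-cong suc-injective (≡.cong suc) (suc i ≟ᶠ suc j) (i ≟ᶠ j) (f (suc i))) ⟩
    ∑[ i < n ] when (i ≟ᶠ j) (f (suc i))
      ≈⟨ ∑-when-≟ j (f ∘ suc) ⟩
    f (suc j)
      ∎

  private variable
    a b : Level
    A : Set a
    B : Set b

  -- Setup.∑ᴸ over an arbitrary commutative ring; on F the two agree definitionally.
  sumᴸ : List A → (A → Carrier) → Carrier
  sumᴸ xs f = foldr (λ x s → f x + s) 0# xs

  sumᴸ-cong : ∀ (xs : List A) {f g : A → Carrier} → (∀ x → f x ≈ g x) → sumᴸ xs f ≈ sumᴸ xs g
  sumᴸ-cong []       _   = refl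
  sumᴸ-cong (x ∷ xs) f≈g = +-cong (f≈g x) (sumᴸ-cong xs f≈g)

  sumᴸ-zero : ∀ (xs : List A) → sumᴸ xs (λ _ → 0#) ≈ 0#
  sumᴸ-zero []       = refl
  sumᴸ-zero (x ∷ xs) = trans (+-identityˡ _) (sumᴸ-zero xs)

  sumᴸ-distrib-+ : ∀ (xs : List A) (f g : A → Carrier) → sumᴸ xs (λ x → f x + g x) ≈ sumᴸ xs f + sumᴸ xs g
  sumᴸ-distrib-+ []       f g = sym (+-identityˡ 0#)
  sumᴸ-distrib-+ (x ∷ xs) f g = trans (+-congˡ (sumᴸ-distrib-+ xs f g)) (+-interchange _ _ _ _)

  sumᴸ-++ : ∀ (xs ys : List A) (f : A → Carrier) → sumᴸ (xs ++ ys) f ≈ sumᴸ xs f + sumᴸ ys f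
  sumᴸ-++ []       ys f = sym (+-identityˡ _)
  sumᴸ-++ (x ∷ xs) ys f = trans (+-congˡ (sumᴸ-++ xs ys f)) (sym (+-assoc _ _ _))

  *-distribˡ-sumᴸ : ∀ x (xs : List A) (f : A → Carrier) → x * sumᴸ xs f ≈ sumᴸ xs (λ y → x * f y)
  *-distribˡ-sumᴸ x []       f = zeroʳ x
  *-distribˡ-sumᴸ x (y ∷ xs) f = trans (distribˡ x _ _) (+-congˡ (*-distribˡ-sumᴸ x xs f))

  *-distribʳ-sumᴸ : ∀ x (xs : List A) (f : A → Carrier) → sumᴸ xs f * x ≈ sumᴸ xs (λ y → f y * x)
  *-distribʳ-sumᴸ x []       f = zeroˡ x
  *-distribʳ-sumᴸ x (y ∷ xs) f = trans (distribʳ x _ _) (+-congˡ (*-distribʳ-sumᴸ x xs f))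

  sumᴸ-∑-comm : ∀ (xs : List A) {n} (f : A → Fin n → Carrier) →
              sumᴸ xs (λ x → ∑[ i < n ] f x i) ≈ ∑[ i < n ] sumᴸ xs (λ x → f x i)
  sumᴸ-∑-comm []       {n} f = sym (sum-replicate-zero n)
  sumᴸ-∑-comm (x ∷ xs)     f = trans (+-congˡ (sumᴸ-∑-comm xs f)) (sym (∑-distrib-+ (f x) _))

  fromℕ-length-filter : ∀ {p} {P : A → Set p} (P? : Decidable P) (xs : List A) →
                      fromℕ R (length (filter P? xs)) ≈ sumᴸ xs (λ x → when (P? x) 1#)
  fromℕ-length-filter P? []       = refl
  fromℕ-length-filter P? (x ∷ xs) with P? x
  ... | yes _ = +-congˡ (fromℕ-length-filter P? xs)
  ... | no  _ = trans (fromℕ-length-filter P? xs) (sym (+-identityˡ _))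

  sumᴸ-map : ∀ (g : A → B) (xs : List A) (f : B → Carrier) → sumᴸ (map g xs) f ≈ sumᴸ xs (f ∘ g)
  sumᴸ-map g []       f = refl
  sumᴸ-map g (x ∷ xs) f = +-congˡ (sumᴸ-map g xs f)

  sumᴸ-concatMap : ∀ (g : A → List B) (xs : List A) (f : B → Carrier) →
                   sumᴸ (concatMap g xs) f ≈ sumᴸ xs (λ x → sumᴸ (g x) f)
  sumᴸ-concatMap g []       f = refl
  sumᴸ-concatMap g (x ∷ xs) f = trans (sumᴸ-++ (g x) _ f) (+-congˡ (sumᴸ-concatMap g xs f))

  sumᴸ-comm : ∀ (xs : List A) (ys : List B) (f : A → B → Carrier) →
              sumᴸ xs (λ x → sumᴸ ys (f x)) ≈ sumᴸ ys (λ y → sumᴸ xs (λ x → f x y))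
  sumᴸ-comm []       ys f = sym (sumᴸ-zero ys)
  sumᴸ-comm (x ∷ xs) ys f = trans (+-congˡ (sumᴸ-comm xs ys f)) (sym (sumᴸ-distrib-+ ys _ _))

  sumᴸ-tabulate : ∀ {n} (g : Fin n → A) (f : A → Carrier) → sumᴸ (tabulate g) f ≈ ∑[ i < n ] f (g i)
  sumᴸ-tabulate {n = zero}  g f = refl
  sumᴸ-tabulate {n = suc n} g f = +-congˡ (sumᴸ-tabulate (g ∘ suc) f)

  fromℕ≈∑1 : ∀ n → fromℕ R n ≈ ∑[ i < n ] 1#
  fromℕ≈∑1 zero    = refl
  fromℕ≈∑1 (suc n) = +-congˡ (fromℕ≈∑1 n)

  module _ (_≟_ : DecidableEquality A) where
    sumᴸ-when-∉ : ∀ {xs : List A} {x} (f : A → Carrier) → x ∉ xs →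
                  sumᴸ xs (λ y → when (y ≟ x) (f y)) ≈ 0#
    sumᴸ-when-∉ {[]}     f x∉ = refl
    sumᴸ-when-∉ {y ∷ xs} {x} f x∉ with y ≟ x
    ... | yes ≡.refl = ⊥-elim (x∉ (here ≡.refl))
    ... | no  _      = trans (+-identityˡ _) (sumᴸ-when-∉ f (x∉ ∘ there))

    sumᴸ-when-≟ : ∀ {xs : List A} {x} (f : A → Carrier) → Unique xs → x ∈ xs →
                  sumᴸ xs (λ y → when (y ≟ x) (f y)) ≈ f x
    sumᴸ-when-≟ {y ∷ xs} {x} f (y∉xs ∷ unique) x∈ with y ≟ x | x∈
    ... | yes ≡.refl | _         = trans (+-congˡ (sumᴸ-when-∉ f (All¬⇒¬Any y∉xs))) (+-identityʳ _)
    ... | no  y≢x    | here x≡y  = ⊥-elim (y≢x (≡.sym x≡y))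
    ... | no  _      | there x∈′ = trans (+-identityˡ _) (sumᴸ-when-≟ f unique x∈′)

    -- Both sides equal ∑_b ∑_a [b = f a] h b, summing first over b resp. first over a = g b.
    sumᴸ-bijection : ∀ {xs : List A} → Unique xs → (∀ x → x ∈ xs) →
                     (h : A → Carrier) (f g : A → A) → (∀ b → f (g b) ≡ b) → (∀ a → g (f a) ≡ a) →
                     sumᴸ xs (h ∘ f) ≈ sumᴸ xs h
    sumᴸ-bijection {xs} unique complete h f g fg gf = begin
      sumᴸ xs (h ∘ f)
        ≈⟨ sumᴸ-cong xs (λ a → sym (sumᴸ-when-≟ h unique (complete (f a)))) ⟩
      sumᴸ xs (λ a → sumᴸ xs (λ b → when (b ≟ f a) (h b)))
        ≈⟨ sumᴸ-comm xs xs _ ⟩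
      sumᴸ xs (λ b → sumᴸ xs (λ a → when (b ≟ f a) (h b)))
        ≈⟨ sumᴸ-cong xs (λ b → sumᴸ-cong xs (λ a →
             when-cong (b≡fa⇒a≡gb b a) (a≡gb⇒b≡fa b a) (b ≟ f a) (a ≟ g b) (h b))) ⟩
      sumᴸ xs (λ b → sumᴸ xs (λ a → when (a ≟ g b) (h b)))
        ≈⟨ sumᴸ-cong xs (λ b → sumᴸ-when-≟ (λ _ → h b) unique (complete (g b))) ⟩
      sumᴸ xs h
        ∎
      where
        b≡fa⇒a≡gb : ∀ b a → b ≡ f a → a ≡ g b
        b≡fa⇒a≡gb b a b≡fa = ≡.trans (≡.sym (gf a)) (≡.cong g (≡.sym b≡fa))
        a≡gb⇒b≡fa : ∀ b a → a ≡ g b → b ≡ f a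
        a≡gb⇒b≡fa b a a≡gb = ≡.trans (≡.sym (fg b)) (≡.cong f (≡.sym a≡gb))

module FieldProperties {c ℓ} (F : Field c ℓ) where
  open Field F hiding (zero)
  open import Algebra.Properties.Ring ring using ([y-z]x≈yx-zx; x∙y⁻¹≈ε⇒x≈y)
  open import Relation.Binary.Reasoning.Setoid setoid

  *-cancelˡ : ∀ {x y z} → ¬ x ≈ 0# → x * y ≈ x * z → y ≈ z
  *-cancelˡ {x} {y} {z} x≉0 xy≈xz = begin
    y                ≈⟨ x⁻¹*[x*_]≈ y ⟨
    x ⁻¹ * (x * y)   ≈⟨ *-congˡ xy≈xz ⟩
    x ⁻¹ * (x * z)   ≈⟨ x⁻¹*[x*_]≈ z ⟩
    z                ∎
    where
      x⁻¹*[x*_]≈ : ∀ w → x ⁻¹ * (x * w) ≈ w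
      x⁻¹*[x*_]≈ w = begin
        x ⁻¹ * (x * w)  ≈⟨ *-assoc _ _ _ ⟨
        x ⁻¹ * x * w    ≈⟨ *-congʳ (trans (*-comm _ _) (inverseʳ x x≉0)) ⟩
        1# * w          ≈⟨ *-identityˡ w ⟩
        w               ∎

  x≉0∧x*y≈0⇒y≈0 : ∀ {x y} → ¬ x ≈ 0# → x * y ≈ 0# → y ≈ 0#
  x≉0∧x*y≈0⇒y≈0 {x} x≉0 xy≈0 = *-cancelˡ x≉0 (trans xy≈0 (sym (zeroʳ x)))

  x≈x*y⇒x≈0 : ∀ {x y} → ¬ y ≈ 1# → x ≈ x * y → x ≈ 0#
  x≈x*y⇒x≈0 {x} {y} y≉1 x≈xy = x≉0∧x*y≈0⇒y≈0 (y≉1 ∘ x∙y⁻¹≈ε⇒x≈y y 1#) (begin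
    (y - 1#) * x    ≈⟨ [y-z]x≈yx-zx x y 1# ⟩
    y * x - 1# * x  ≈⟨ +-cong (trans (*-comm y x) (sym x≈xy)) (-‿cong (*-identityˡ x)) ⟩
    x - x           ≈⟨ -‿inverseʳ x ⟩
    0#              ∎)

  fromℕ≉0 : CharZero F → ∀ {n} → 0 < n → ¬ fromℕ commutativeRing n ≈ 0#
  fromℕ≉0 char0 {suc n} _ = char0 n

module DotProduct {c ℓ} (R : CommutativeRing c ℓ) where
  open CommutativeRing R hiding (zero)
  open Sums R
  open import Relation.Binary.Reasoning.Setoid setoid

  private variable
    k n : ℕ

  infix 7 _∙_
  _∙_ : (Fin n → Carrier) → (Fin n → Carrier) → Carrier
  u ∙ v = ∑[ j < _ ] (u j * v j)

  ∙-congˡ : ∀ {u u′ : Fin n → Carrier} (v : Fin n → Carrier) → (∀ j → u j ≈ u′ j) → u ∙ v ≈ u′ ∙ v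
  ∙-congˡ v u≈u′ = sum-cong-≋ (λ j → *-congʳ (u≈u′ j))

  ∙-congʳ : ∀ (u : Fin n → Carrier) {v v′ : Fin n → Carrier} → (∀ j → v j ≈ v′ j) → u ∙ v ≈ u ∙ v′
  ∙-congʳ u v≈v′ = sum-cong-≋ (λ j → *-congˡ (v≈v′ j))

  ∙-distribˡ-+ : ∀ (u v w : Fin n → Carrier) → u ∙ (λ j → v j + w j) ≈ u ∙ v + u ∙ w
  ∙-distribˡ-+ u v w = trans (sum-cong-≋ (λ j → distribˡ (u j) (v j) (w j)))
                             (∑-distrib-+ (λ j → u j * v j) (λ j → u j * w j))

  ∙-distribʳ-+ : ∀ (u v w : Fin n → Carrier) → (λ j → u j + v j) ∙ w ≈ u ∙ w + v ∙ w
  ∙-distribʳ-+ u v w = trans (sum-cong-≋ (λ j → distribʳ (w j) (u j) (v j)))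
                             (∑-distrib-+ (λ j → u j * w j) (λ j → v j * w j))

  ∙-negʳ : ∀ (u v : Fin n → Carrier) → u ∙ (λ j → - v j) ≈ - (u ∙ v)
  ∙-negʳ u v = trans (sum-cong-≋ (λ j → sym (-‿distribʳ-* (u j) (v j)))) (∑-neg (λ j → u j * v j))
    where open import Algebra.Properties.Ring ring using (-‿distribʳ-*)

  ∙-zeroʳ : ∀ (u : Fin n → Carrier) {v : Fin n → Carrier} → (∀ j → v j ≈ 0#) → u ∙ v ≈ 0#
  ∙-zeroʳ {n} u v≈0 = trans (sum-cong-≋ (λ j → trans (*-congˡ (v≈0 j)) (zeroʳ (u j)))) (sum-replicate-zero n)

  ∙-basisˡ : ∀ (j : Fin n) x (v : Fin n → Carrier) → (λ i → when (i ≟ᶠ j) x) ∙ v ≈ x * v j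
  ∙-basisˡ j x v = trans (sum-cong-≋ (λ i → when-*ʳ (i ≟ᶠ j))) (∑-when-≟ j (λ i → x * v i))
    where
      when-*ʳ : ∀ {p} {P : Set p} (d : Dec P) {y} → when d x * y ≈ when d (x * y)
      when-*ʳ (yes _) = refl
      when-*ʳ (no _)  = zeroˡ _

  ∙-transpose : ∀ (M : Fin k → Fin n → Carrier) (b : Fin n → Carrier) (u : Fin k → Carrier) →
                (λ r → M r ∙ b) ∙ u ≈ b ∙ (λ j → (λ r → M r j) ∙ u)
  ∙-transpose {k} {n} M b u = begin
    ∑[ r < k ] (∑[ j < n ] (M r j * b j) * u r)   ≈⟨ sum-cong-≋ (λ r → *-distribʳ-sum (u r) (λ j → M r j * b j)) ⟩
    ∑[ r < k ] ∑[ j < n ] (M r j * b j * u r)     ≈⟨ ∑-comm (λ r j → M r j * b j * u r) ⟩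
    ∑[ j < n ] ∑[ r < k ] (M r j * b j * u r)     ≈⟨ sum-cong-≋ (λ j → sum-cong-≋ (λ r → swap-b (M r j) (b j) (u r))) ⟩
    ∑[ j < n ] ∑[ r < k ] (b j * (M r j * u r))   ≈⟨ sum-cong-≋ (λ j → *-distribˡ-sum (b j) (λ r → M r j * u r)) ⟨
    ∑[ j < n ] (b j * ∑[ r < k ] (M r j * u r))   ∎
    where
      swap-b : ∀ m x y → m * x * y ≈ x * (m * y)
      swap-b m x y = trans (*-congʳ (*-comm m x)) (*-assoc x m y)

module LinearAlgebra {c ℓ} (K : FiniteField) (F : Field c ℓ) where
  open Setup K F
  private
    module K = FiniteField K
    module ΣK = Sums K.commutativeRing
  open DotProduct K.commutativeRing
  open import Algebra.Properties.Ring K.ring using (//-rightDividesʳ)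
  open import Relation.Binary.Reasoning.Setoid K.setoid

  private variable
    k n : ℕ

  0⃗ : Vecᴷ n
  0⃗ _ = K.0#

  infixl 30 _⊕_
  _⊕_ : Vecᴷ n → Vecᴷ n → Vecᴷ n
  (v ⊕ w) i = v i K.+ w i

  infix 35 ⊖_
  ⊖_ : Vecᴷ n → Vecᴷ n
  (⊖ v) i = K.- v i

  ∑ᴷ≡sum : ∀ n (f : Fin n → K.Carrier) → ∑ᴷ n f ≡ ΣK.sum f
  ∑ᴷ≡sum zero    f = ≡.refl
  ∑ᴷ≡sum (suc n) f = ≡.cong (f zero K.+_) (∑ᴷ≡sum n (f ∘ suc))

  apply≡∙ : ∀ (M : Mat k n) b r → apply M b r ≡ M r ∙ b
  apply≡∙ {n = n} M b r = ∑ᴷ≡sum n (λ j → M r j K.* b j)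

  applyᵀ≡∙ : ∀ (M : Mat k n) u j → applyᵀ M u j ≡ (λ r → M r j) ∙ u
  applyᵀ≡∙ {k = k} M u j = ∑ᴷ≡sum k (λ r → M r j K.* u r)

  apply-cong : ∀ (M : Mat k n) {b b′} → b ≋ b′ → apply M b ≋ apply M b′
  apply-cong M {b} {b′} b≋b′ r = K.≈⇒≡ (begin
    apply M b r   ≡⟨ apply≡∙ M b r ⟩
    M r ∙ b       ≈⟨ ∙-congʳ (M r) (K.reflexive ∘ b≋b′) ⟩
    M r ∙ b′      ≡⟨ apply≡∙ M b′ r ⟨
    apply M b′ r  ∎)

  apply-⊕ : ∀ (M : Mat k n) b b′ → apply M (b ⊕ b′) ≋ apply M b ⊕ apply M b′
  apply-⊕ M b b′ r = K.≈⇒≡ (begin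
    apply M (b ⊕ b′) r            ≡⟨ apply≡∙ M (b ⊕ b′) r ⟩
    M r ∙ (b ⊕ b′)                ≈⟨ ∙-distribˡ-+ (M r) b b′ ⟩
    M r ∙ b K.+ M r ∙ b′          ≡⟨ ≡.cong₂ K._+_ (apply≡∙ M b r) (apply≡∙ M b′ r) ⟨
    apply M b r K.+ apply M b′ r  ∎)

  apply-⊖ : ∀ (M : Mat k n) b → apply M (⊖ b) ≋ ⊖ apply M b
  apply-⊖ M b r = K.≈⇒≡ (begin
    apply M (⊖ b) r    ≡⟨ apply≡∙ M (⊖ b) r ⟩
    M r ∙ (⊖ b)        ≈⟨ ∙-negʳ (M r) b ⟩
    K.- (M r ∙ b)      ≡⟨ ≡.cong K.-_ (apply≡∙ M b r) ⟨
    K.- apply M b r    ∎)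

  apply-0⃗ : ∀ (M : Mat k n) → apply M 0⃗ ≋ 0⃗
  apply-0⃗ M r = K.≈⇒≡ (K.trans (K.reflexive (apply≡∙ M 0⃗ r)) (∙-zeroʳ (M r) (λ _ → K.refl)))

  apply-adjoint : ∀ (M : Mat k n) b u → apply M b ∙ u ≡ b ∙ applyᵀ M u
  apply-adjoint M b u = K.≈⇒≡ (begin
    apply M b ∙ u                    ≈⟨ ∙-congˡ u (K.reflexive ∘ apply≡∙ M b) ⟩
    (λ r → M r ∙ b) ∙ u              ≈⟨ ∙-transpose M b u ⟩
    b ∙ (λ j → (λ r → M r j) ∙ u)    ≈⟨ ∙-congʳ b (K.reflexive ∘ applyᵀ≡∙ M u) ⟨
    b ∙ applyᵀ M u                   ∎)

  ∙-surjective : ∀ {w : Vecᴷ n} → ¬ w ≋ 0⃗ → ∀ a → ∃ λ b → b ∙ w ≡ a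
  ∙-surjective {n} {w} w≉0 a with ¬∀⟶∃¬ n (λ j → w j ≡ K.0#) (λ j → w j K.≟ K.0#) w≉0
  ... | j , wⱼ≢0 = (λ i → ΣK.when (i ≟ᶠ j) x) , K.≈⇒≡ (begin
      (λ i → ΣK.when (i ≟ᶠ j) x) ∙ w   ≈⟨ ∙-basisˡ j x w ⟩
      a K.* w j K.⁻¹ K.* w j           ≈⟨ K.*-assoc a _ _ ⟩
      a K.* (w j K.⁻¹ K.* w j)         ≈⟨ K.*-congˡ (K.trans (K.*-comm _ _) (K.inverseʳ (w j) (wⱼ≢0 ∘ K.≈⇒≡))) ⟩
      a K.* K.1#                       ≈⟨ K.*-identityʳ a ⟩
      a                                ∎)
    where x = a K.* w j K.⁻¹

  allVecs-complete : ∀ k (v : Vecᴷ k) → ∃ λ w → w ∈ allVecs k × w ≋ v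
  allVecs-complete zero    v = (λ ()) , here ≡.refl , (λ ())
  allVecs-complete (suc k) v with allVecs-complete k (v ∘ suc)
  ... | w , w∈ , w≋v = cons (v zero) w , cons-v₀-w∈ , λ { zero → ≡.refl ; (suc i) → w≋v i }
    where
      cons-v₀-w∈ : cons (v zero) w ∈ allVecs (suc k)
      cons-v₀-w∈ = ∈-concatMap⁺ (λ a → map (cons a) (allVecs k))
                     (Any.map (λ { ≡.refl → ∈-map⁺ (cons (v zero)) w∈ }) (K.complete (v zero)))

  module _ {M : Mat k n} where
    ∈Im-intro : ∀ b {v} → apply M b ≋ v → v ∈Im M
    ∈Im-intro b Mb≋v with allVecs-complete _ b
    ... | b′ , b′∈ , b′≋b = b′ , b′∈ , λ r → ≡.trans (apply-cong M b′≋b r) (Mb≋v r)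

    ∈Im-resp : ∀ {v w} → v ≋ w → v ∈Im M → w ∈Im M
    ∈Im-resp v≋w (b , b∈ , Mb≋v) = b , b∈ , λ r → ≡.trans (Mb≋v r) (v≋w r)

    0⃗∈Im : 0⃗ ∈Im M
    0⃗∈Im = ∈Im-intro 0⃗ (apply-0⃗ M)

    ∈Im-⊕ : ∀ {v w} → v ∈Im M → w ∈Im M → (v ⊕ w) ∈Im M
    ∈Im-⊕ (b , _ , Mb≋v) (b′ , _ , Mb′≋w) =
      ∈Im-intro (b ⊕ b′) (λ r → ≡.trans (apply-⊕ M b b′ r) (≡.cong₂ K._+_ (Mb≋v r) (Mb′≋w r)))

    ∈Im-⊖ : ∀ {v} → v ∈Im M → (⊖ v) ∈Im M
    ∈Im-⊖ (b , _ , Mb≋v) = ∈Im-intro (⊖ b) (λ r → ≡.trans (apply-⊖ M b r) (≡.cong K.-_ (Mb≋v r)))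

    ∈Im-⊕⁻ : ∀ {v w} → (v ⊕ w) ∈Im M → w ∈Im M → v ∈Im M
    ∈Im-⊕⁻ {v} {w} v⊕w∈ w∈ =
      ∈Im-resp (λ i → K.≈⇒≡ (//-rightDividesʳ (w i) (v i))) (∈Im-⊕ v⊕w∈ (∈Im-⊖ w∈))

  module _ {M : Mat k n} {u : Vecᴷ k} where
    ∈Im-orthogonal : applyᵀ M u ≋ 0⃗ → ∀ {v} → v ∈Im M → v ∙ u ≡ K.0#
    ∈Im-orthogonal Mᵀu≋0 {v} (b , _ , Mb≋v) = K.≈⇒≡ (begin
      v ∙ u               ≈⟨ ∙-congˡ u (K.reflexive ∘ Mb≋v) ⟨
      apply M b ∙ u       ≡⟨ apply-adjoint M b u ⟩
      b ∙ applyᵀ M u      ≈⟨ ∙-zeroʳ b (K.reflexive ∘ Mᵀu≋0) ⟩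
      K.0#                ∎)

    ∈Im-∙-surjective : ¬ applyᵀ M u ≋ 0⃗ → ∀ a → ∃ λ v → v ∈Im M × v ∙ u ≡ a
    ∈Im-∙-surjective Mᵀu≉0 a with ∙-surjective Mᵀu≉0 a
    ... | b , b∙Mᵀu≡a = apply M b , ∈Im-intro b (λ _ → ≡.refl) , ≡.trans (apply-adjoint M b u) b∙Mᵀu≡a

module HammingWeight {c ℓ} (K : FiniteField) (F : Field c ℓ) where
  open Setup K F
  open LinearAlgebra K F using (0⃗)
  open Field F hiding (zero)
  open Sums commutativeRing
  open import Relation.Binary.Reasoning.Setoid setoid

  wt+zeros≈m : ∀ {m n} (x : Fin m → Vecᴷ n) →
               fromℕ commutativeRing (wt x) + ∑[ i < m ] when (x i ≋? 0⃗) 1# ≈ fromℕ commutativeRing m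
  wt+zeros≈m {m} x = begin
    fromℕ commutativeRing (wt x) + ∑[ i < m ] Z i
      ≈⟨ +-congʳ (trans (fromℕ-length-filter (λ i → NonZero? (x i)) (tabulate (λ i → i)))
                        (sumᴸ-tabulate (λ i → i) (λ i → when (NonZero? (x i)) 1#))) ⟩
    ∑[ i < m ] when (¬? (x i ≋? 0⃗)) 1# + ∑[ i < m ] Z i
      ≈⟨ ∑-distrib-+ (λ i → when (¬? (x i ≋? 0⃗)) 1#) Z ⟨
    ∑[ i < m ] (when (¬? (x i ≋? 0⃗)) 1# + Z i)
      ≈⟨ sum-cong-≋ (λ i → when-¬?+when (x i ≋? 0⃗)) ⟩
    ∑[ i < m ] 1#
      ≈⟨ fromℕ≈∑1 m ⟨
    fromℕ commutativeRing m
      ∎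
    where
      Z : Fin m → Carrier
      Z i = when (x i ≋? 0⃗) 1#

module CharacterSums {c ℓ} (K : FiniteField) (F : Field c ℓ) (ψ : Setup.Character K F) where
  open Setup K F
  open LinearAlgebra K F
  open DotProduct (FiniteField.commutativeRing K) using (_∙_; ∙-congˡ; ∙-distribʳ-+)
  open Field F hiding (zero)
  open Character ψ
  open Sums commutativeRing
  open FieldProperties F
  open import Relation.Binary.Reasoning.Setoid setoid
  private
    module K = FiniteField K

  private variable
    k n : ℕ

  π-0 : π K.0# ≈ 1#
  π-0 = *-cancelˡ (nonzero K.0#) (begin
    π K.0# * π K.0#     ≈⟨ hom K.0# K.0# ⟨
    π (K.0# K.+ K.0#)   ≡⟨ ≡.cong π (K.≈⇒≡ (K.+-identityˡ K.0#)) ⟩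
    π K.0#              ≈⟨ *-identityʳ _ ⟨
    π K.0# * 1#         ∎)

  χ≡π∙ : ∀ (v u : Vecᴷ k) → χ ψ v u ≡ π (v ∙ u)
  χ≡π∙ {k} v u = ≡.cong π (∑ᴷ≡sum k (λ j → v j K.* u j))

  χ-cong : ∀ {v v′ : Vecᴷ k} (u : Vecᴷ k) → v ≋ v′ → χ ψ v u ≈ χ ψ v′ u
  χ-cong {v = v} {v′} u v≋v′ = begin
    χ ψ v u     ≡⟨ χ≡π∙ v u ⟩
    π (v ∙ u)   ≡⟨ ≡.cong π (K.≈⇒≡ (∙-congˡ u (K.reflexive ∘ v≋v′))) ⟩
    π (v′ ∙ u)  ≡⟨ χ≡π∙ v′ u ⟨
    χ ψ v′ u    ∎

  χ-⊕ : ∀ (v w u : Vecᴷ k) → χ ψ (v ⊕ w) u ≈ χ ψ v u * χ ψ w u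
  χ-⊕ v w u = begin
    χ ψ (v ⊕ w) u                ≡⟨ χ≡π∙ (v ⊕ w) u ⟩
    π ((v ⊕ w) ∙ u)              ≡⟨ ≡.cong π (K.≈⇒≡ (∙-distribʳ-+ v w u)) ⟩
    π (v ∙ u K.+ w ∙ u)          ≈⟨ hom (v ∙ u) (w ∙ u) ⟩
    π (v ∙ u) * π (w ∙ u)        ≡⟨ ≡.cong₂ _*_ (χ≡π∙ v u) (χ≡π∙ w u) ⟨
    χ ψ v u * χ ψ w u            ∎

  sumᴸ-allVecs-suc : ∀ k (g : Vecᴷ (suc k) → Carrier) →
                     sumᴸ (allVecs (suc k)) g ≈ sumᴸ K.elements (λ a → sumᴸ (allVecs k) (g ∘ cons a))
  sumᴸ-allVecs-suc k g =
    trans (sumᴸ-concatMap _ K.elements g) (sumᴸ-cong K.elements (λ a → sumᴸ-map (cons a) (allVecs k) g))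

  -- On the first coordinate, translation is the bijection a ↦ a + t₀ of K.
  sumᴸ-allVecs-translate : ∀ k (g : Vecᴷ k → Carrier) → (∀ {v w} → v ≋ w → g v ≈ g w) →
                           ∀ t → sumᴸ (allVecs k) (λ v → g (v ⊕ t)) ≈ sumᴸ (allVecs k) g
  sumᴸ-allVecs-translate zero    g g-cong t = +-congʳ (g-cong (λ ()))
  sumᴸ-allVecs-translate (suc k) g g-cong t = begin
    sumᴸ (allVecs (suc k)) (λ v → g (v ⊕ t))
      ≈⟨ sumᴸ-allVecs-suc k _ ⟩
    sumᴸ K.elements (λ a → sumᴸ (allVecs k) (λ v → g (cons a v ⊕ t)))
      ≈⟨ sumᴸ-cong K.elements (λ a → sumᴸ-cong (allVecs k) (λ v → g-cong (cons-⊕ a v))) ⟩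
    sumᴸ K.elements (λ a → sumᴸ (allVecs k) (λ v → g (cons (a K.+ t zero) (v ⊕ (t ∘ suc)))))
      ≈⟨ sumᴸ-cong K.elements (λ a →
           sumᴸ-allVecs-translate k (g ∘ cons (a K.+ t zero)) (g-cong ∘ cons-cong) (t ∘ suc)) ⟩
    sumᴸ K.elements (λ a → sumᴸ (allVecs k) (g ∘ cons (a K.+ t zero)))
      ≈⟨ sumᴸ-bijection K._≟_ K.unique K.complete (λ a → sumᴸ (allVecs k) (g ∘ cons a))
           (K._+ t zero) (K._- t zero)
           (λ b → K.≈⇒≡ (//-rightDividesˡ (t zero) b)) (λ a → K.≈⇒≡ (//-rightDividesʳ (t zero) a)) ⟩
    sumᴸ K.elements (λ a → sumᴸ (allVecs k) (g ∘ cons a))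
      ≈⟨ sumᴸ-allVecs-suc k g ⟨
    sumᴸ (allVecs (suc k)) g
      ∎
    where
      open import Algebra.Properties.Ring K.ring using (//-rightDividesˡ; //-rightDividesʳ)
      cons-⊕ : ∀ a v → cons a v ⊕ t ≋ cons (a K.+ t zero) (v ⊕ (t ∘ suc))
      cons-⊕ a v zero    = ≡.refl
      cons-⊕ a v (suc i) = ≡.refl
      cons-cong : ∀ {a} {v w : Vecᴷ k} → v ≋ w → cons a v ≋ cons a w
      cons-cong v≋w zero    = ≡.refl
      cons-cong v≋w (suc i) = v≋w i

  module _ (M : Mat k n) where
    𝟙≈when : ∀ v → 𝟙 M v ≈ when (v ∈Im? M) 1#
    𝟙≈when v with v ∈Im? M
    ... | yes _ = refl
    ... | no  _ = refl

    𝟙-cong : ∀ {v w} → (v ∈Im M → w ∈Im M) → (w ∈Im M → v ∈Im M) → 𝟙 M v ≈ 𝟙 M w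
    𝟙-cong {v} {w} to from = trans (𝟙≈when v) (trans (when-cong to from (v ∈Im? M) (w ∈Im? M) 1#) (sym (𝟙≈when w)))

    𝟙-translate : ∀ {v₀} → v₀ ∈Im M → ∀ v → 𝟙 M (v ⊕ v₀) ≈ 𝟙 M v
    𝟙-translate v₀∈ v = 𝟙-cong (λ v⊕v₀∈ → ∈Im-⊕⁻ v⊕v₀∈ v₀∈) (λ v∈ → ∈Im-⊕ v∈ v₀∈)

    card≈sumᴸ𝟙 : fromℕ commutativeRing (card M) ≈ sumᴸ (allVecs k) (𝟙 M)
    card≈sumᴸ𝟙 = trans (fromℕ-length-filter (_∈Im? M) (allVecs k)) (sumᴸ-cong (allVecs k) (sym ∘ 𝟙≈when))

    card≉0 : CharZero F → ¬ fromℕ commutativeRing (card M) ≈ 0#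
    card≉0 char0 with allVecs-complete k 0⃗
    ... | z , z∈ , z≋0 = fromℕ≉0 char0 (∈-length (∈-filter⁺ (_∈Im? M) z∈ (∈Im-resp (≡.sym ∘ z≋0) 0⃗∈Im)))

  module _ (M : Mat k n) (u : Vecᴷ k) where
    sumᴸ-𝟙χ-kernel : applyᵀ M u ≋ 0⃗ → sumᴸ (allVecs k) (λ v → 𝟙 M v * χ ψ v u) ≈ fromℕ commutativeRing (card M)
    sumᴸ-𝟙χ-kernel Mᵀu≋0 = trans (sumᴸ-cong (allVecs k) 𝟙χ≈𝟙) (sym (card≈sumᴸ𝟙 M))
      where
        𝟙χ≈𝟙 : ∀ v → 𝟙 M v * χ ψ v u ≈ 𝟙 M v
        𝟙χ≈𝟙 v with v ∈Im? M
        ... | no  _  = zeroˡ _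
        ... | yes v∈ = begin
          1# * χ ψ v u   ≈⟨ *-identityˡ _ ⟩
          χ ψ v u        ≡⟨ χ≡π∙ v u ⟩
          π (v ∙ u)      ≡⟨ ≡.cong π (∈Im-orthogonal Mᵀu≋0 v∈) ⟩
          π K.0#         ≈⟨ π-0 ⟩
          1#             ∎

    -- Translating by some v₀ ∈ σ*(L) with χ_{v₀}(u) ≠ 1 multiplies the sum by χ_{v₀}(u).
    sumᴸ-𝟙χ-nonkernel : ¬ applyᵀ M u ≋ 0⃗ → sumᴸ (allVecs k) (λ v → 𝟙 M v * χ ψ v u) ≈ 0#
    sumᴸ-𝟙χ-nonkernel Mᵀu≉0 with nontriv
    ... | a , πa≉1 with ∈Im-∙-surjective Mᵀu≉0 a
    ...   | v₀ , v₀∈ , v₀∙u≡a = x≈x*y⇒x≈0 χv₀≉1 (begin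
      sumᴸ A g                             ≈⟨ sumᴸ-allVecs-translate k g g-cong v₀ ⟨
      sumᴸ A (λ v → g (v ⊕ v₀))            ≈⟨ sumᴸ-cong A g-translate ⟩
      sumᴸ A (λ v → g v * χ ψ v₀ u)        ≈⟨ *-distribʳ-sumᴸ (χ ψ v₀ u) A g ⟨
      sumᴸ A g * χ ψ v₀ u                  ∎)
      where
        A = allVecs k
        g : Vecᴷ k → Carrier
        g v = 𝟙 M v * χ ψ v u
        g-cong : ∀ {v w} → v ≋ w → g v ≈ g w
        g-cong v≋w = *-cong (𝟙-cong M (∈Im-resp v≋w) (∈Im-resp (≡.sym ∘ v≋w))) (χ-cong u v≋w)
        g-translate : ∀ v → g (v ⊕ v₀) ≈ g v * χ ψ v₀ u
        g-translate v = trans (*-cong (𝟙-translate M v₀∈ v) (χ-⊕ v v₀ u)) (sym (*-assoc _ _ _))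
        χv₀≉1 : ¬ χ ψ v₀ u ≈ 1#
        χv₀≉1 χv₀≈1 = πa≉1 (trans (reflexive (≡.sym (≡.trans (χ≡π∙ v₀ u) (≡.cong π v₀∙u≡a)))) χv₀≈1)

    card⁻¹*sumᴸ-𝟙χ : CharZero F →
      fromℕ commutativeRing (card M) ⁻¹ * sumᴸ (allVecs k) (λ v → 𝟙 M v * χ ψ v u) ≈ when (applyᵀ M u ≋? 0⃗) 1#
    card⁻¹*sumᴸ-𝟙χ char0 with applyᵀ M u ≋? 0⃗
    ... | yes Mᵀu≋0 = trans (*-congˡ (sumᴸ-𝟙χ-kernel Mᵀu≋0)) (trans (*-comm _ _) (inverseʳ _ (card≉0 M char0)))
    ... | no  Mᵀu≉0 = trans (*-congˡ (sumᴸ-𝟙χ-nonkernel Mᵀu≉0)) (zeroʳ _)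

  ∑ᶠ≡sum : ∀ m (f : Fin m → Carrier) → ∑ᶠ m f ≡ sum f
  ∑ᶠ≡sum zero    f = ≡.refl
  ∑ᶠ≡sum (suc m) f = ≡.cong (f zero +_) (∑ᶠ≡sum m (f ∘ suc))

  sumᴸ-weighted-𝟙χ : CharZero F → ∀ {k n m} (Λ : Fin m → Mat k n) (u : Vecᴷ k) →
    ∑ᴸ (allVecs k) (λ v → ∑ᶠ m (λ i → fromℕ commutativeRing (card (Λ i)) ⁻¹ * 𝟙 (Λ i) v) * χ ψ v u)
    ≈ ∑[ i < m ] when (applyᵀ (Λ i) u ≋? 0⃗) 1#
  sumᴸ-weighted-𝟙χ char0 {k} {n} {m} Λ u = begin
    sumᴸ A (λ v → ∑ᶠ m (λ i → |V| i ⁻¹ * 𝟙 (Λ i) v) * χ ψ v u)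
      ≈⟨ sumᴸ-cong A (λ v → trans (*-congʳ (reflexive (∑ᶠ≡sum m _)))
                                  (*-distribʳ-sum (χ ψ v u) (λ i → |V| i ⁻¹ * 𝟙 (Λ i) v))) ⟩
    sumᴸ A (λ v → ∑[ i < m ] (|V| i ⁻¹ * 𝟙 (Λ i) v * χ ψ v u))
      ≈⟨ sumᴸ-∑-comm A (λ v i → |V| i ⁻¹ * 𝟙 (Λ i) v * χ ψ v u) ⟩
    ∑[ i < m ] sumᴸ A (λ v → |V| i ⁻¹ * 𝟙 (Λ i) v * χ ψ v u)
      ≈⟨ sum-cong-≋ (λ i → trans (sumᴸ-cong A (λ v → *-assoc _ _ _)) (sym (*-distribˡ-sumᴸ (|V| i ⁻¹) A _))) ⟩
    ∑[ i < m ] (|V| i ⁻¹ * sumᴸ A (λ v → 𝟙 (Λ i) v * χ ψ v u))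
      ≈⟨ sum-cong-≋ (λ i → card⁻¹*sumᴸ-𝟙χ (Λ i) u char0) ⟩
    ∑[ i < m ] when (applyᵀ (Λ i) u ≋? 0⃗) 1#
      ∎
    where
      A = allVecs k
      |V| : Fin m → Carrier
      |V| i = fromℕ commutativeRing (card (Λ i))

proposition12 : ∀ {c ℓ} (K : FiniteField) (F : Field c ℓ) → CharZero F →
  let open Setup K F
      open Field F
  in (ψ : Character) (k n m : ℕ) (Λ : Fin m → Mat k n) (u : Vecᴷ k) →
     fromℕ commutativeRing (wt (λ i → applyᵀ (Λ i) u))
     ≈ (fromℕ commutativeRing m
        - ∑ᴸ (allVecs k) (λ v →
            ∑ᶠ m (λ i → (fromℕ commutativeRing (card (Λ i)) ⁻¹) * 𝟙 (Λ i) v)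
            * χ ψ v u))
proposition12 K F char0 ψ k n m Λ u = begin
  fromℕ commutativeRing (wt λu)
    ≈⟨ //-rightDividesʳ zeros (fromℕ commutativeRing (wt λu)) ⟨
  fromℕ commutativeRing (wt λu) + zeros - zeros
    ≈⟨ +-congʳ (wt+zeros≈m λu) ⟩
  fromℕ commutativeRing m - zeros
    ≈⟨ +-congˡ (-‿cong (sumᴸ-weighted-𝟙χ char0 Λ u)) ⟨
  fromℕ commutativeRing m - ∑ᴸ (allVecs k) (λ v →
    ∑ᶠ m (λ i → fromℕ commutativeRing (card (Λ i)) ⁻¹ * 𝟙 (Λ i) v) * χ ψ v u)
    ∎
  where
    open Setup K F
    open Field F hiding (zero)
    open LinearAlgebra K F using (0⃗)
    open Sums commutativeRing using (sum-syntax; when)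
    open HammingWeight K F
    open CharacterSums K F ψ
    open import Algebra.Properties.Ring ring using (//-rightDividesʳ)
    open import Relation.Binary.Reasoning.Setoid setoid
    λu : Fin m → Vecᴷ n
    λu i = applyᵀ (Λ i) u
    zeros : Carrier
    zeros = ∑[ i < m ] when (λu i ≋? 0⃗) 1#
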